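{- For every positive integer $n$, $$t(1,2,6,6;n)=2N(1,2,6,6;8n+15)-N(1,2,6,6;16n+30)$$ and $$t(2,2,3,6;n)=2N(2,2,3,6;8n+13)-N(2,2,3,6;16n+26).$$
   Context: For positive integers $a_1,\dots,a_k$ and a nonnegative integer $n$, $N(a_1,\dots,a_k;n)$ is the number of $(x_1,\dots,x_k)\in\mathbb Z^k$ with $n=a_1x_1^2+\cdots+a_kx_k^2$, and $t(a_1,\dots,a_k;n)$ is the number of $(x_1,\dots,x_k)\in\mathbb Z^k$ with $n=a_1\frac{x_1(x_1-1)}2+\cdots+a_k\frac{x_k(x_k-1)}2$. -}

module Defs where

open import Data.Nat as ℕ using (ℕ; suc)
open import Data.Integer as ℤ using (ℤ; +_; -[1+_]; _+_; _*_; _-_)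
open import Data.List using (List; []; _∷_; map; concatMap; filter; length)
open import Data.Product using (_×_; _,_)
open import Relation.Binary.PropositionalEquality using (_≡_)
open import Data.Integer.Properties using (_≟_)

range : ℕ → List ℤ
range ℕ.zero = + 0 ∷ []
range (suc B) = + (suc B) ∷ -[1+ B ] ∷ range B

box4 : ℕ → List (ℤ × ℤ × ℤ × ℤ)
box4 B = concatMap (λ x₁ → concatMap (λ x₂ → concatMap (λ x₃ → map (λ x₄ → x₁ , x₂ , x₃ , x₄) (range B)) (range B)) (range B)) (range B)

sq : ℤ → ℤ
sq x = x * x

-- twice the "triangular" value x(x-1)/2, i.e. x(x-1)
tri2 : ℤ → ℤ
tri2 x = x * (x - + 1)

-- N(a₁,a₂,a₃,a₄;n) = #{x ∈ ℤ⁴ : n = Σ aᵢ xᵢ²}.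
-- Any solution has |xᵢ| ≤ xᵢ² ≤ n (as aᵢ ≥ 1), so searching in [-n, n]⁴ is exhaustive.
N4 : ℕ → ℕ → ℕ → ℕ → ℕ → ℕ
N4 a₁ a₂ a₃ a₄ n = length (filter
  (λ { (x₁ , x₂ , x₃ , x₄) → (+ a₁ * sq x₁ + + a₂ * sq x₂ + + a₃ * sq x₃ + + a₄ * sq x₄) ≟ + n })
  (box4 n))

-- t(a₁,a₂,a₃,a₄;n) = #{x ∈ ℤ⁴ : n = Σ aᵢ xᵢ(xᵢ-1)/2}, stated equivalently (clearing the
-- denominator) as 2n = Σ aᵢ xᵢ(xᵢ-1).  Any solution has xᵢ(xᵢ-1)/2 ≤ n, hence
-- -n ≤ xᵢ ≤ n+1, so searching in [-(n+1), n+1]⁴ is exhaustive.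
t4 : ℕ → ℕ → ℕ → ℕ → ℕ → ℕ
t4 a₁ a₂ a₃ a₄ n = length (filter
  (λ { (x₁ , x₂ , x₃ , x₄) → (+ a₁ * tri2 x₁ + + a₂ * tri2 x₂ + + a₃ * tri2 x₃ + + a₄ * tri2 x₄) ≟ + (2 ℕ.* n) })
  (box4 (suc n)))

{-# OPTIONS --safe #-}
-- Both identities are instances of one statement about the forms F = ⟨g, 2g, 2h, 2h⟩ and
-- G = ⟨g, 2g, h, h⟩ with {g, h} = {1, 3} (for ⟨2, 2, 3, 6⟩ after reordering the coordinates).
-- Put m = 8n + g + 2g + 4h and let R_ij count the solutions of G(x, y, a, b) = m with
-- a ≡ i and b ≡ j (mod 2), where e = even and o = odd.
--
-- Completing the square, x ↦ 2x − 1 identifies t(F; n) with the representations of m by F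
-- with all coordinates odd. Through G(x, y, z + w, z − w) = F(x, y, z, w) these correspond to
-- the solutions with a, b even, because modulo 8 such a solution has a ≢ b (mod 4), so that
-- (a ± b)/2 is odd; hence t(F; n) = R_ee. The same substitution gives N(F; m) = R_ee + R_oo,
-- and F(2y, x, a, b) = 2 G(x, y, a, b) gives N(F; 2m) = R_ee + R_eo + R_oe + R_oo. Exchanging
-- a and b shows R_eo = R_oe. When a is odd, x ≡ b (mod 2), and the reflection
-- (u, v) ↦ ((u + 3v)/2, (u − v)/2) of the norm u² + 3v², applied to x and b, matches the
-- solutions with a, b odd and x ≡ b (mod 4) with those counted by R_oe, while b ↦ −b matches
-- them with the solutions with x ≢ b (mod 4); so R_oo = 2 R_oe and
-- 2 N(F; m) − N(F; 2m) = R_ee = t(F; n). All parity facts are decided by evaluation mod 8.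
module Submission where

module Counting where

  open import Level using (0ℓ)
  open import Function using (_∘_)
  open import Data.Nat using (suc; _+_; _≤_; z≤n; s≤s)
  open import Data.Nat.Properties using (≤-antisym; ≤-reflexive; ≤-trans; +-suc)
  open import Data.Empty using (⊥-elim)
  open import Data.List using (List; []; _∷_; _++_; filter; length)
  open import Data.List.Properties using (length-++-sucʳ)
  open import Data.List.Membership.Propositional using (_∈_)
  open import Data.List.Membership.Propositional.Properties
    using (∈-∃++; ∈-++⁻; ∈-++⁺ˡ; ∈-++⁺ʳ; ∈-filter⁺; ∈-filter⁻)
  open import Data.List.Relation.Unary.Any using (here; there)
  open import Data.List.Relation.Unary.All using (lookup)
  open import Data.List.Relation.Unary.Unique.Propositional using (Unique; []; _∷_)
  open import Data.List.Relation.Unary.Unique.Propositional.Properties using (filter⁺)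
  open import Data.Product using (_,_; proj₂)
  open import Data.Sum using (inj₁; inj₂)
  open import Relation.Nullary using (yes; no)
  open import Relation.Unary using (Pred; Decidable)
  open import Relation.Unary.Properties using (_∩?_; ∁?)
  open import Relation.Binary.PropositionalEquality using (_≡_; refl; sym; trans; cong)

  private
    variable
      A B : Set
      P Q D : Pred A 0ℓ
      xs ys : List A

  infix 4 _≅_
  record _≅_ {A B : Set} (P : Pred A 0ℓ) (Q : Pred B 0ℓ) : Set where
    field
      to      : A → B
      from    : B → A
      to-∈    : ∀ x → P x → Q (to x)
      from-∈  : ∀ y → Q y → P (from y)
      from-to : ∀ x → P x → from (to x) ≡ x
      to-from : ∀ y → Q y → to (from y) ≡ y

  ≅-sym : P ≅ Q → Q ≅ P
  ≅-sym e = record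
    { to = from ; from = to
    ; to-∈ = from-∈ ; from-∈ = to-∈
    ; from-to = to-from ; to-from = from-to
    }
    where open _≅_ e

  length-≤-injection : (f : A → B) → Unique xs → (∀ {x} → x ∈ xs → f x ∈ ys) →
    (∀ {x y} → x ∈ xs → y ∈ xs → f x ≡ f y → x ≡ y) → length xs ≤ length ys
  length-≤-injection f [] _ _ = z≤n
  length-≤-injection {xs = x ∷ xs} f (x∉xs ∷ unique) maps injective with ∈-∃++ (maps (here refl))
  ... | ys₁ , ys₂ , refl = ≤-trans
    (s≤s (length-≤-injection f unique maps′ (λ p q → injective (there p) (there q))))
    (≤-reflexive (sym (length-++-sucʳ ys₁ (f x) ys₂)))
    where
    maps′ : ∀ {y} → y ∈ xs → f y ∈ ys₁ ++ ys₂
    maps′ {y} y∈xs with ∈-++⁻ ys₁ (maps (there y∈xs))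
    ... | inj₁ p = ∈-++⁺ˡ p
    ... | inj₂ (here fy≡fx) =
      ⊥-elim (lookup x∉xs y∈xs (injective (here refl) (there y∈xs) (sym fy≡fx)))
    ... | inj₂ (there p) = ∈-++⁺ʳ ys₁ p

  filter-length-≤ : (P? : Decidable P) (Q? : Decidable Q) → Unique xs →
    (∀ y → Q y → y ∈ ys) → P ≅ Q → length (filter P? xs) ≤ length (filter Q? ys)
  filter-length-≤ {P = P} {xs = xs} {ys = ys} P? Q? unique Q⊆ys e =
    length-≤-injection to (filter⁺ P? unique) maps injective
    where
    open _≅_ e
    satisfies : ∀ {x} → x ∈ filter P? xs → P x
    satisfies = proj₂ ∘ ∈-filter⁻ P? {xs = xs}
    maps : ∀ {x} → x ∈ filter P? xs → to x ∈ filter Q? ys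
    maps {x} x∈ = let Qx = to-∈ x (satisfies x∈) in ∈-filter⁺ Q? (Q⊆ys (to x) Qx) Qx
    injective : ∀ {x y} → x ∈ filter P? xs → y ∈ filter P? xs → to x ≡ to y → x ≡ y
    injective {x} {y} x∈ y∈ eq =
      trans (sym (from-to x (satisfies x∈))) (trans (cong from eq) (from-to y (satisfies y∈)))

  filter-length-≅ : (P? : Decidable P) (Q? : Decidable Q) → Unique xs → Unique ys →
    (∀ x → P x → x ∈ xs) → (∀ y → Q y → y ∈ ys) → P ≅ Q →
    length (filter P? xs) ≡ length (filter Q? ys)
  filter-length-≅ P? Q? unique-xs unique-ys P⊆xs Q⊆ys e = ≤-antisym
    (filter-length-≤ P? Q? unique-xs Q⊆ys e)
    (filter-length-≤ Q? P? unique-ys P⊆xs (≅-sym e))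

  filter-length-split : (P? : Decidable P) (D? : Decidable D) (xs : List A) →
    length (filter P? xs) ≡ length (filter (P? ∩? D?) xs) + length (filter (P? ∩? ∁? D?) xs)
  filter-length-split P? D? [] = refl
  filter-length-split P? D? (x ∷ xs) with P? x | D? x
  ... | yes _ | yes _ = cong suc (filter-length-split P? D? xs)
  ... | yes _ | no _  = trans (cong suc (filter-length-split P? D? xs)) (sym (+-suc _ _))
  ... | no _  | _     = filter-length-split P? D? xs

module Boxes where

  open import Level using (0ℓ)
  open import Function using (id; _∘_)
  open import Data.Nat using (ℕ; zero; suc; _≤_; _+_; z≤n)
  open import Data.Nat.Properties using (≤-refl; ≤-trans; n≤1+n; m≤n⇒m<n∨m≡n; ≤-pred; 1+n≰n)
  open import Data.Integer using (ℤ; +_; -[1+_]; ∣_∣)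
  open import Data.List using ([]; _∷_; _++_; map; concatMap; cartesianProduct; filter; length)
  open import Data.List.Properties using (map-++; map-∘; map-id; concatMap-cong)
  open import Data.List.Membership.Propositional using (_∈_)
  open import Data.List.Membership.Propositional.Properties using (∈-cartesianProduct⁺)
  open import Data.List.Relation.Unary.Any using (here; there)
  open import Data.List.Relation.Unary.All using (All; []; _∷_; tabulate)
  open import Data.List.Relation.Unary.Unique.Propositional using (Unique; []; _∷_)
  open import Data.List.Relation.Unary.Unique.Propositional.Properties using (cartesianProduct⁺)
  open import Data.Product using (_×_; _,_; proj₁)
  open import Data.Sum using (inj₁; inj₂)
  open import Relation.Unary using (Pred; Decidable; _∩_)
  open import Relation.Unary.Properties using (_∩?_; ∁?)
  open import Relation.Binary.PropositionalEquality
    using (_≡_; _≢_; refl; trans; cong₂; module ≡-Reasoning)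
  open import Defs using (range; box4)
  open Counting

  V : Set
  V = ℤ × ℤ × ℤ × ℤ

  π₁ π₃ π₄ : V → ℤ
  π₁ (x₁ , _ , _ , _) = x₁
  π₃ (_ , _ , x₃ , _) = x₃
  π₄ (_ , _ , _ , x₄) = x₄

  ≡-tuple : ∀ {x₁ x₂ x₃ x₄ y₁ y₂ y₃ y₄ : ℤ} → x₁ ≡ y₁ → x₂ ≡ y₂ → x₃ ≡ y₃ → x₄ ≡ y₄ →
    (x₁ , x₂ , x₃ , x₄) ≡ (y₁ , y₂ , y₃ , y₄)
  ≡-tuple refl refl refl refl = refl

  ∈-range : ∀ {B x} → ∣ x ∣ ≤ B → x ∈ range B
  ∈-range {zero} {+ zero} z≤n = here refl
  ∈-range {suc B} {+ n} ∣x∣≤ with m≤n⇒m<n∨m≡n ∣x∣≤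
  ... | inj₂ refl = here refl
  ... | inj₁ ∣x∣< = there (there (∈-range (≤-pred ∣x∣<)))
  ∈-range {suc B} { -[1+ n ]} ∣x∣≤ with m≤n⇒m<n∨m≡n ∣x∣≤
  ... | inj₂ refl = there (here refl)
  ... | inj₁ ∣x∣< = there (there (∈-range (≤-pred ∣x∣<)))

  ∈-range⁻ : ∀ {B x} → x ∈ range B → ∣ x ∣ ≤ B
  ∈-range⁻ {zero} (here refl) = z≤n
  ∈-range⁻ {suc B} (here refl) = ≤-refl
  ∈-range⁻ {suc B} (there (here refl)) = ≤-refl
  ∈-range⁻ {suc B} (there (there x∈)) = ≤-trans (∈-range⁻ x∈) (n≤1+n B)

  range-unique : ∀ B → Unique (range B)
  range-unique zero = [] ∷ []
  range-unique (suc B) = ((λ ()) ∷ fresh ≤-refl) ∷ fresh ≤-refl ∷ range-unique B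
    where
    fresh : ∀ {x} → suc B ≤ ∣ x ∣ → All (x ≢_) (range B)
    fresh B<∣x∣ = tabulate λ { y∈ refl → 1+n≰n (≤-trans B<∣x∣ (∈-range⁻ y∈)) }

  concatMap-map≡map-cartesianProduct : ∀ {A B C : Set} (p : A × B → C) xs ys →
    concatMap (λ x → map (λ y → p (x , y)) ys) xs ≡ map p (cartesianProduct xs ys)
  concatMap-map≡map-cartesianProduct p [] ys = refl
  concatMap-map≡map-cartesianProduct p (x ∷ xs) ys = begin
    map (λ y → p (x , y)) ys ++ concatMap (λ x → map (λ y → p (x , y)) ys) xs
      ≡⟨ cong₂ _++_ (map-∘ ys) (concatMap-map≡map-cartesianProduct p xs ys) ⟩
    map p (map (x ,_) ys) ++ map p (cartesianProduct xs ys)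
      ≡⟨ map-++ p (map (x ,_) ys) (cartesianProduct xs ys) ⟨
    map p (map (x ,_) ys ++ cartesianProduct xs ys) ∎
    where open ≡-Reasoning

  box4≡cartesianProduct : ∀ B → let R = range B in
    box4 B ≡ cartesianProduct R (cartesianProduct R (cartesianProduct R R))
  box4≡cartesianProduct B = begin
    box4 B
      ≡⟨ concatMap-cong (λ x₁ → trans
           (concatMap-cong (λ x₂ → concatMap-map≡map-cartesianProduct (λ q → x₁ , x₂ , q) R R) R)
           (concatMap-map≡map-cartesianProduct (x₁ ,_) R (cartesianProduct R R))) R ⟩
    concatMap (λ x₁ → map (x₁ ,_) (cartesianProduct R (cartesianProduct R R))) R
      ≡⟨ concatMap-map≡map-cartesianProduct id R (cartesianProduct R (cartesianProduct R R)) ⟩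
    map id (cartesianProduct R (cartesianProduct R (cartesianProduct R R)))
      ≡⟨ map-id _ ⟩
    cartesianProduct R (cartesianProduct R (cartesianProduct R R)) ∎
    where
    R = range B
    open ≡-Reasoning

  box4-unique : ∀ B → Unique (box4 B)
  box4-unique B rewrite box4≡cartesianProduct B =
    cartesianProduct⁺ R (cartesianProduct⁺ R (cartesianProduct⁺ R R))
    where R = range-unique B

  ∈-box4 : ∀ {B x₁ x₂ x₃ x₄} → ∣ x₁ ∣ ≤ B → ∣ x₂ ∣ ≤ B → ∣ x₃ ∣ ≤ B → ∣ x₄ ∣ ≤ B →
    (x₁ , x₂ , x₃ , x₄) ∈ box4 B
  ∈-box4 {B} b₁ b₂ b₃ b₄ rewrite box4≡cartesianProduct B =
    ∈-cartesianProduct⁺ (∈-range b₁)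
      (∈-cartesianProduct⁺ (∈-range b₂) (∈-cartesianProduct⁺ (∈-range b₃) (∈-range b₄)))

  data Bounded (P : Pred V 0ℓ) (B : ℕ) : Set where
    bounded : (∀ v → P v → v ∈ box4 B) → Bounded P B

  ∩-bounded : ∀ {P Q : Pred V 0ℓ} {B} → Bounded P B → Bounded (P ∩ Q) B
  ∩-bounded (bounded P⊆box) = bounded λ v → P⊆box v ∘ proj₁

  count : {P : Pred V 0ℓ} → Decidable P → ℕ → ℕ
  count P? B = length (filter P? (box4 B))

  count-≅ : ∀ {P Q : Pred V 0ℓ} {B B′} (P? : Decidable P) (Q? : Decidable Q) →
    Bounded P B → Bounded Q B′ → P ≅ Q → count P? B ≡ count Q? B′
  count-≅ {B = B} {B′} P? Q? (bounded P⊆box) (bounded Q⊆box) =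
    filter-length-≅ P? Q? (box4-unique B) (box4-unique B′) P⊆box Q⊆box

  count-split : ∀ {P D : Pred V 0ℓ} (P? : Decidable P) (D? : Decidable D) B →
    count P? B ≡ count (P? ∩? D?) B + count (P? ∩? ∁? D?) B
  count-split P? D? B = filter-length-split P? D? (box4 B)

module Residues where

  open import Function using (_∘′_)
  open import Data.Nat as ℕ using (ℕ; suc; _<_; _%_; _/_)
  open import Data.Nat.Properties using (allUpTo?)
  import Data.Nat.Properties as ℕ
  open import Data.Nat.DivMod using (m<n⇒m%n≡m; [m+kn]%n≡m%n; m≡m%n+[m/n]*n)
  open import Data.Integer using (ℤ; +_; -[1+_]; _+_; _*_; -_; _-_; _%ℕ_; _/ℕ_)
  open import Data.Integer.Properties using (pos-+; pos-*; +-injective; *-cancelˡ-≡)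
  open import Data.Integer.DivMod using (n%ℕd<d; a≡a%ℕn+[a/ℕn]*n)
  open import Data.Integer.Tactic.RingSolver using (solve-∀)
  open import Data.Nat.Tactic.RingSolver renaming (solve-∀ to ℕ-solve-∀)
  open import Relation.Nullary using (¬_; Dec)
  open import Relation.Nullary.Decidable using (from-yes; ¬?; _→-dec_)
  open import Relation.Unary using (Decidable)
  open import Relation.Binary.PropositionalEquality
    using (_≡_; refl; sym; trans; cong; subst; subst₂; module ≡-Reasoning)

  res : ℤ → ℕ
  res x = x %ℕ 8

  res<8 : ∀ x → res x < 8
  res<8 x = n%ℕd<d x 8

  infix 4 _≡₈_
  data _≡₈_ (x y : ℤ) : Set where
    mk≡₈ : ∀ k → x ≡ y + k * + 8 → x ≡₈ y

  ≡₈-res : ∀ x → x ≡₈ + res x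
  ≡₈-res x = mk≡₈ (x /ℕ 8) (a≡a%ℕn+[a/ℕn]*n x 8)

  ≡₈-refl : ∀ x → x ≡₈ x
  ≡₈-refl x = mk≡₈ (+ 0) (lemma x)
    where
    lemma : ∀ x → x ≡ x + + 0 * + 8
    lemma = solve-∀

  ≡₈-sym : ∀ {x y} → x ≡₈ y → y ≡₈ x
  ≡₈-sym {y = y} (mk≡₈ k refl) = mk≡₈ (- k) (lemma y k)
    where
    lemma : ∀ y k → y ≡ y + k * + 8 + - k * + 8
    lemma = solve-∀

  ≡₈-trans : ∀ {x y z} → x ≡₈ y → y ≡₈ z → x ≡₈ z
  ≡₈-trans {z = z} (mk≡₈ k refl) (mk≡₈ l refl) = mk≡₈ (l + k) (lemma z k l)
    where
    lemma : ∀ z k l → z + l * + 8 + k * + 8 ≡ z + (l + k) * + 8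
    lemma = solve-∀

  ≡₈-+ : ∀ {x x′ y y′} → x ≡₈ x′ → y ≡₈ y′ → x + y ≡₈ x′ + y′
  ≡₈-+ {x′ = x′} {y′ = y′} (mk≡₈ k refl) (mk≡₈ l refl) = mk≡₈ (k + l) (lemma x′ y′ k l)
    where
    lemma : ∀ x y k l → x + k * + 8 + (y + l * + 8) ≡ x + y + (k + l) * + 8
    lemma = solve-∀

  ≡₈-* : ∀ {x x′ y y′} → x ≡₈ x′ → y ≡₈ y′ → x * y ≡₈ x′ * y′
  ≡₈-* {x′ = x′} {y′ = y′} (mk≡₈ k refl) (mk≡₈ l refl) =
    mk≡₈ (k * y′ + x′ * l + k * l * + 8) (lemma x′ y′ k l)
    where
    lemma : ∀ x y k l → (x + k * + 8) * (y + l * + 8) ≡ x * y + (k * y + x * l + k * l * + 8) * + 8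
    lemma = solve-∀

  ≡₈-neg : ∀ {x x′} → x ≡₈ x′ → - x ≡₈ - x′
  ≡₈-neg {x′ = x′} (mk≡₈ k refl) = mk≡₈ (- k) (lemma x′ k)
    where
    lemma : ∀ x k → - (x + k * + 8) ≡ - x + - k * + 8
    lemma = solve-∀

  ≡₈-- : ∀ {x x′ y y′} → x ≡₈ x′ → y ≡₈ y′ → x - y ≡₈ x′ - y′
  ≡₈-- p q = ≡₈-+ p (≡₈-neg q)

  private
    residue-unique⁺ : ∀ {r s} k → r < 8 → s < 8 → + r ≡ + s + + k * + 8 → r ≡ s
    residue-unique⁺ {r} {s} k r<8 s<8 eq = begin
      r                   ≡⟨ m<n⇒m%n≡m r<8 ⟨
      r % 8               ≡⟨ cong (_% 8) (+-injective (trans eq s+8k≡)) ⟩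
      (s ℕ.+ k ℕ.* 8) % 8 ≡⟨ [m+kn]%n≡m%n s k 8 ⟩
      s % 8               ≡⟨ m<n⇒m%n≡m s<8 ⟩
      s                   ∎
      where
      open ≡-Reasoning
      s+8k≡ : + s + + k * + 8 ≡ + (s ℕ.+ k ℕ.* 8)
      s+8k≡ = trans (cong (λ t → + s + t) (sym (pos-* k 8))) (sym (pos-+ s (k ℕ.* 8)))

    residue-unique : ∀ {r s} → r < 8 → s < 8 → + r ≡₈ + s → r ≡ s
    residue-unique r<8 s<8 (mk≡₈ (+ k) eq) = residue-unique⁺ k r<8 s<8 eq
    residue-unique r<8 s<8 (mk≡₈ -[1+ k ] eq) =
      sym (residue-unique⁺ (suc k) s<8 r<8 (swap-sides {j = + suc k} eq))
      where
      swap-sides : ∀ {x y j} → x ≡ y + - j * + 8 → y ≡ x + j * + 8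
      swap-sides {y = y} {j} refl = lemma y j
        where
        lemma : ∀ y j → y ≡ y + - j * + 8 + j * + 8
        lemma = solve-∀

  res-≡₈ : ∀ {x y} → x ≡₈ y → res x ≡ res y
  res-≡₈ {x} {y} x≡y = residue-unique (res<8 x) (res<8 y)
    (≡₈-trans (≡₈-sym (≡₈-res x)) (≡₈-trans x≡y (≡₈-res y)))

  res≡₈ : ∀ x → + res x ≡₈ x
  res≡₈ x = ≡₈-sym (≡₈-res x)

  res-subst : ∀ {x y} (P : ℕ → Set) → x ≡₈ y → P (res x) → P (res y)
  res-subst P x≡y = subst P (res-≡₈ x≡y)

  res-subst⁻ : ∀ {x y} (P : ℕ → Set) → x ≡₈ y → P (res y) → P (res x)
  res-subst⁻ P x≡y = res-subst P (≡₈-sym x≡y)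

  res-8n+k : ∀ n k → res (+ (8 ℕ.* n ℕ.+ k)) ≡ k % 8
  res-8n+k n k = trans (cong (_% 8) (lemma n k)) ([m+kn]%n≡m%n k n 8)
    where
    lemma : ∀ n k → 8 ℕ.* n ℕ.+ k ≡ k ℕ.+ n ℕ.* 8
    lemma = ℕ-solve-∀

  even odd : ℕ → Set
  even r = r % 2 ≡ 0
  odd r = ¬ even r

  even? : Decidable even
  even? r = r % 2 ℕ.≟ 0

  Even Odd : ℤ → Set
  Even x = even (res x)
  Odd x = odd (res x)

  Even? : Decidable Even
  Even? x = even? (res x)

  infix 4 _≡₄_ _≡₄?_
  _≡₄_ : ℤ → ℤ → Set
  x ≡₄ y = res x % 4 ≡ res y % 4

  _≡₄?_ : ∀ x y → Dec (x ≡₄ y)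
  x ≡₄? y = res x % 4 ℕ.≟ res y % 4

  ≡₄-subst : ∀ {x x′ y y′} → x ≡₈ x′ → y ≡₈ y′ → x ≡₄ y → x′ ≡₄ y′
  ≡₄-subst p q = subst₂ (λ r s → r % 4 ≡ s % 4) (res-≡₈ p) (res-≡₈ q)

  ∀₈ : (ℕ → Set) → Set
  ∀₈ P = ∀ {r} → r < 8 → P r

  ∀₈? : {P : ℕ → Set} → Decidable P → Dec (∀₈ P)
  ∀₈? P? = allUpTo? P? 8

  lift₁ : {Φ : ℤ → Set} → (∀ {x x′} → x ≡₈ x′ → Φ x → Φ x′) → (∀₈ λ r → Φ (+ r)) → ∀ x → Φ x
  lift₁ invariant check x = invariant (res≡₈ x) (check (res<8 x))

  lift₂ : {Φ : ℤ → ℤ → Set} → (∀ {x x′ y y′} → x ≡₈ x′ → y ≡₈ y′ → Φ x y → Φ x′ y′) →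
    (∀₈ λ r → ∀₈ λ s → Φ (+ r) (+ s)) → ∀ x y → Φ x y
  lift₂ invariant check x y = invariant (res≡₈ x) (res≡₈ y) (check (res<8 x) (res<8 y))

  even-double : ∀ z → Even (+ 2 * z)
  even-double = lift₁ (res-subst even ∘′ ≡₈-* (≡₈-refl (+ 2)))
    (from-yes (∀₈? λ r → Even? (+ 2 * + r)))

  even-square : ∀ z → Even (z * z) → Even z
  even-square = lift₁ (λ p φ e → res-subst even p (φ (res-subst⁻ even (≡₈-* p p) e)))
    (from-yes (∀₈? λ r → Even? (+ r * + r) →-dec Even? (+ r)))

  odd-factor : ∀ c x → Odd c → Even (c * x) → Even x
  odd-factor = lift₂
    (λ p q φ oc e → res-subst even q (φ (res-subst⁻ odd p oc) (res-subst⁻ even (≡₈-* p q) e)))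
    (from-yes (∀₈? λ c → ∀₈? λ x → ¬? (Even? (+ c)) →-dec Even? (+ c * + x) →-dec Even? (+ x)))

  odd-multiple-of-square : ∀ c x → Odd c → Even (c * (x * x)) → Even x
  odd-multiple-of-square c x oc = even-square x ∘′ odd-factor c (x * x) oc

  even-of-sum : ∀ x r k → x + + 2 * r ≡ + 2 * k → Even x
  even-of-sum x r k eq = subst Even (sym x≡2[k-r]) (even-double (k - r))
    where
    lemma : ∀ x r → x ≡ x + + 2 * r - + 2 * r
    lemma = solve-∀
    lemma′ : ∀ k r → + 2 * k - + 2 * r ≡ + 2 * (k - r)
    lemma′ = solve-∀
    x≡2[k-r] : x ≡ + 2 * (k - r)
    x≡2[k-r] = trans (lemma x r) (trans (cong (_- + 2 * r) eq) (lemma′ k r))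

  odd-2x-1 : ∀ x → Odd (+ 2 * x - + 1)
  odd-2x-1 = lift₁ (res-subst odd ∘′ λ p → ≡₈-- (≡₈-* (≡₈-refl (+ 2)) p) (≡₈-refl (+ 1)))
    (from-yes (∀₈? λ r → ¬? (Even? (+ 2 * + r - + 1))))

  odd⇒even-suc : ∀ y → Odd y → Even (y + + 1)
  odd⇒even-suc = lift₁
    (λ p φ o → res-subst even (≡₈-+ p (≡₈-refl (+ 1))) (φ (res-subst⁻ odd p o)))
    (from-yes (∀₈? λ r → ¬? (Even? (+ r)) →-dec Even? (+ r + + 1)))

  -- Exact on even integers. Defined through z = res z + 8 ⌊z/8⌋, so that evenness of z,
  -- a condition on res z, is all that half-spec needs.
  half : ℤ → ℤ
  half z = + (res z / 2) + z /ℕ 8 * + 4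

  half-spec : ∀ z → Even z → + 2 * half z ≡ z
  half-spec z e = begin
    + 2 * half z                       ≡⟨ lemma (+ (res z / 2)) (z /ℕ 8) ⟩
    + 2 * + (res z / 2) + z /ℕ 8 * + 8  ≡⟨ cong (_+ z /ℕ 8 * + 8) twice-half ⟩
    + res z + z /ℕ 8 * + 8              ≡⟨ a≡a%ℕn+[a/ℕn]*n z 8 ⟨
    z                                  ∎
    where
    open ≡-Reasoning
    lemma : ∀ h q → + 2 * (h + q * + 4) ≡ + 2 * h + q * + 8
    lemma = solve-∀
    twice-half : + 2 * + (res z / 2) ≡ + res z
    twice-half = trans (sym (pos-* 2 (res z / 2))) (cong +_ (trans (ℕ.*-comm 2 (res z / 2))
      (sym (trans (m≡m%n+[m/n]*n (res z) 2) (cong (ℕ._+ (res z / 2) ℕ.* 2) e)))))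

  half-double : ∀ z → half (+ 2 * z) ≡ z
  half-double z = *-cancelˡ-≡ (+ 2) (half (+ 2 * z)) z (half-spec (+ 2 * z) (even-double z))

module Substitutions where

  open import Function using (_∘′_)
  open import Data.Integer using (ℤ; +_; _+_; _*_; -_; _-_)
  open import Data.Integer.Properties using (neg-involutive)
  open import Data.Integer.Tactic.RingSolver using (solve-∀)
  open import Data.Product using (_×_; _,_)
  open import Relation.Nullary using (¬_)
  open import Relation.Nullary.Decidable using (from-yes; ¬?; _×-dec_; _→-dec_)
  open import Relation.Binary.PropositionalEquality using (_≡_; refl; sym; trans; cong; subst)
  open Residues

  even-sum⇒even-difference : ∀ z w → Even (z + w) → Even (z - w)
  even-sum⇒even-difference = lift₂
    (λ p q φ → res-subst even (≡₈-- p q) ∘′ φ ∘′ res-subst⁻ even (≡₈-+ p q))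
    (from-yes (∀₈? λ z → ∀₈? λ w → Even? (+ z + + w) →-dec Even? (+ z - + w)))

  even-difference⇒even-sum : ∀ z w → Even (z - w) → Even (z + w)
  even-difference⇒even-sum z w e =
    subst (λ t → Even (z + t)) (neg-involutive w) (even-sum⇒even-difference z (- w) e)

  even-even⇒even-difference : ∀ a b → Even a → Even b → Even (a - b)
  even-even⇒even-difference = lift₂
    (λ p q φ ea eb → res-subst even (≡₈-- p q) (φ (res-subst⁻ even p ea) (res-subst⁻ even q eb)))
    (from-yes (∀₈? λ a → ∀₈? λ b → Even? (+ a) →-dec Even? (+ b) →-dec Even? (+ a - + b)))

  odd-odd⇒even-difference : ∀ a b → Odd a → Odd b → Even (a - b)
  odd-odd⇒even-difference = lift₂
    (λ p q φ oa ob → res-subst even (≡₈-- p q) (φ (res-subst⁻ odd p oa) (res-subst⁻ odd q ob)))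
    (from-yes (∀₈? λ a → ∀₈? λ b →
      ¬? (Even? (+ a)) →-dec ¬? (Even? (+ b)) →-dec Even? (+ a - + b)))

  even-difference-comm : ∀ a b → Even (a - b) → Even (b - a)
  even-difference-comm = lift₂
    (λ p q φ → res-subst even (≡₈-- q p) ∘′ φ ∘′ res-subst⁻ even (≡₈-- p q))
    (from-yes (∀₈? λ a → ∀₈? λ b → Even? (+ a - + b) →-dec Even? (+ b - + a)))

  odd-odd⇒even-sum : ∀ a b → Odd a → Odd b → Even (a + b)
  odd-odd⇒even-sum a b oa ob = even-difference⇒even-sum a b (odd-odd⇒even-difference a b oa ob)

  odd-neg : ∀ v → Odd v → Odd (- v)
  odd-neg = lift₁ (λ p φ → res-subst odd (≡₈-neg p) ∘′ φ ∘′ res-subst⁻ odd p)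
    (from-yes (∀₈? λ v → ¬? (Even? (+ v)) →-dec ¬? (Even? (- + v))))

  odd-≡₄-neg : ∀ u v → Odd u → Odd v → (u ≡₄ v → ¬ u ≡₄ - v) × (¬ u ≡₄ v → u ≡₄ - v)
  odd-≡₄-neg = lift₂
    (λ p q φ ou ov → let (f , g) = φ (res-subst⁻ odd p ou) (res-subst⁻ odd q ov) in
       (λ c → f (≡₄-subst (≡₈-sym p) (≡₈-sym q) c) ∘′ ≡₄-subst (≡₈-sym p) (≡₈-sym (≡₈-neg q))) ,
       (≡₄-subst p (≡₈-neg q) ∘′ g ∘′ (_∘′ ≡₄-subst p q)))
    (from-yes (∀₈? λ u → ∀₈? λ v → ¬? (Even? (+ u)) →-dec ¬? (Even? (+ v)) →-dec
       ((+ u ≡₄? + v →-dec ¬? (+ u ≡₄? - + v)) ×-dec (¬? (+ u ≡₄? + v) →-dec + u ≡₄? - + v))))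

  OddCongruent EvenIncongruent : ℤ → ℤ → Set
  OddCongruent u v = Odd u × Odd v × u ≡₄ v
  EvenIncongruent u v = Even u × Even v × ¬ u ≡₄ v

  OddCongruent-≡₈ : ∀ {u u′ v v′} → u ≡₈ u′ → v ≡₈ v′ → OddCongruent u v → OddCongruent u′ v′
  OddCongruent-≡₈ p q (ou , ov , c) = res-subst odd p ou , res-subst odd q ov , ≡₄-subst p q c

  EvenIncongruent-≡₈ : ∀ {u u′ v v′} → u ≡₈ u′ → v ≡₈ v′ →
    EvenIncongruent u v → EvenIncongruent u′ v′
  EvenIncongruent-≡₈ p q (eu , ev , n) =
    res-subst even p eu , res-subst even q ev , n ∘′ ≡₄-subst (≡₈-sym p) (≡₈-sym q)

  EvenIncongruent-sum-difference⇒odd : ∀ z w → EvenIncongruent (z + w) (z - w) → Odd z × Odd w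
  EvenIncongruent-sum-difference⇒odd = lift₂
    (λ p q φ c → let (oz , ow) = φ (EvenIncongruent-≡₈ (≡₈-sym (≡₈-+ p q)) (≡₈-sym (≡₈-- p q)) c)
                 in res-subst odd p oz , res-subst odd q ow)
    (from-yes (∀₈? λ z → ∀₈? λ w → let s = + z + + w ; d = + z - + w in
       (Even? s ×-dec Even? d ×-dec ¬? (s ≡₄? d)) →-dec (¬? (Even? (+ z)) ×-dec ¬? (Even? (+ w)))))

  half-pair : ∀ z w → half ((z + w) - (z - w)) ≡ w
  half-pair z w = trans (cong half (lemma z w)) (half-double w)
    where
    lemma : ∀ z w → (z + w) - (z - w) ≡ + 2 * w
    lemma = solve-∀

  unpair-sum : ∀ a b → Even (a - b) → b + half (a - b) + half (a - b) ≡ a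
  unpair-sum a b e =
    trans (lemma b (half (a - b))) (trans (cong (λ t → b + t) (half-spec (a - b) e)) (lemma′ a b))
    where
    lemma : ∀ b d → b + d + d ≡ b + + 2 * d
    lemma = solve-∀
    lemma′ : ∀ a b → b + (a - b) ≡ a
    lemma′ = solve-∀

  unpair-difference : ∀ b d → b + d - d ≡ b
  unpair-difference = solve-∀

  -- σ (u, v) = ((u + 3v)/2, (u − v)/2) for u ≡ v (mod 2): a reflection preserving u² + 3v²,
  -- written through d = (u − v)/2 so that a single halving occurs.
  σ₁ σ₂ : ℤ → ℤ → ℤ
  σ₂ u v = half (u - v)
  σ₁ u v = + 2 * v + σ₂ u v

  private
    σ-parametrisation : ∀ u v → Even (u - v) → u ≡ v + + 2 * σ₂ u v
    σ-parametrisation u v e = trans (lemma u v) (cong (λ t → v + t) (sym (half-spec (u - v) e)))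
      where
      lemma : ∀ u v → u ≡ v + (u - v)
      lemma = solve-∀

    σ-coordinates-≡₈ : ∀ {v v′ d d′} → v ≡₈ v′ → d ≡₈ d′ →
      (v + + 2 * d ≡₈ v′ + + 2 * d′) × (+ 2 * v + d ≡₈ + 2 * v′ + d′)
    σ-coordinates-≡₈ p q = ≡₈-+ p (≡₈-* (≡₈-refl (+ 2)) q) , ≡₈-+ (≡₈-* (≡₈-refl (+ 2)) p) q

    OddCongruent⇒EvenIncongruent : ∀ v d →
      OddCongruent (v + + 2 * d) v → EvenIncongruent (+ 2 * v + d) d
    OddCongruent⇒EvenIncongruent = lift₂
      (λ p q φ c → let (P , R) = σ-coordinates-≡₈ p q in
         EvenIncongruent-≡₈ R q (φ (OddCongruent-≡₈ (≡₈-sym P) (≡₈-sym p) c)))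
      (from-yes (∀₈? λ v → ∀₈? λ d → let u = + v + + 2 * + d ; u′ = + 2 * + v + + d in
         (¬? (Even? u) ×-dec ¬? (Even? (+ v)) ×-dec u ≡₄? + v) →-dec
         (Even? u′ ×-dec Even? (+ d) ×-dec ¬? (u′ ≡₄? + d))))

    EvenIncongruent⇒OddCongruent : ∀ v d →
      EvenIncongruent (v + + 2 * d) v → OddCongruent (+ 2 * v + d) d
    EvenIncongruent⇒OddCongruent = lift₂
      (λ p q φ c → let (P , R) = σ-coordinates-≡₈ p q in
         OddCongruent-≡₈ R q (φ (EvenIncongruent-≡₈ (≡₈-sym P) (≡₈-sym p) c)))
      (from-yes (∀₈? λ v → ∀₈? λ d → let u = + v + + 2 * + d ; u′ = + 2 * + v + + d in
         (Even? u ×-dec Even? (+ v) ×-dec ¬? (u ≡₄? + v)) →-dec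
         (¬? (Even? u′) ×-dec ¬? (Even? (+ d)) ×-dec u′ ≡₄? + d)))

  σ-involutive : ∀ u v → Even (u - v) → σ₁ (σ₁ u v) (σ₂ u v) ≡ u × σ₂ (σ₁ u v) (σ₂ u v) ≡ v
  σ-involutive u v e =
    trans (cong (λ t → + 2 * d + t) v′≡v) (trans (lemma v d) (sym (σ-parametrisation u v e))) ,
    v′≡v
    where
    d = σ₂ u v
    lemma : ∀ v d → + 2 * d + v ≡ v + + 2 * d
    lemma = solve-∀
    v′≡v : σ₂ (σ₁ u v) d ≡ v
    v′≡v = trans (cong half (lemma′ v d)) (half-double v)
      where
      lemma′ : ∀ v d → + 2 * v + d - d ≡ + 2 * v
      lemma′ = solve-∀

  σ-norm : ∀ u v → Even (u - v) →
    σ₁ u v * σ₁ u v + + 3 * (σ₂ u v * σ₂ u v) ≡ u * u + + 3 * (v * v)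
  σ-norm u v e = trans (lemma v (σ₂ u v))
    (cong (λ t → t * t + + 3 * (v * v)) (sym (σ-parametrisation u v e)))
    where
    lemma : ∀ v d → (+ 2 * v + d) * (+ 2 * v + d) + + 3 * (d * d) ≡
                    (v + + 2 * d) * (v + + 2 * d) + + 3 * (v * v)
    lemma = solve-∀

  σ-OddCongruent : ∀ u v → OddCongruent u v → EvenIncongruent (σ₁ u v) (σ₂ u v)
  σ-OddCongruent u v c@(ou , ov , _) =
    via (σ-parametrisation u v (odd-odd⇒even-difference u v ou ov)) c
    where
    via : ∀ {u d} → u ≡ v + + 2 * d → OddCongruent u v → EvenIncongruent (+ 2 * v + d) d
    via {d = d} refl = OddCongruent⇒EvenIncongruent v d

  σ-EvenIncongruent : ∀ u v → EvenIncongruent u v → OddCongruent (σ₁ u v) (σ₂ u v)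
  σ-EvenIncongruent u v c@(eu , ev , _) =
    via (σ-parametrisation u v (even-even⇒even-difference u v eu ev)) c
    where
    via : ∀ {u d} → u ≡ v + + 2 * d → EvenIncongruent u v → OddCongruent (+ 2 * v + d) d
    via {d = d} refl = EvenIncongruent⇒OddCongruent v d

module Forms where

  open import Level using (0ℓ)
  open import Data.Nat as ℕ using (ℕ; zero; suc; _≤_; z≤n; s≤s)
  import Data.Nat.Properties as ℕ
  open import Data.Integer using (ℤ; +_; -[1+_]; _+_; _*_; _-_; ∣_∣)
  open import Data.Integer.Properties using (pos-*; +-injective; *-cancelˡ-≡; _≟_)
  open import Data.Integer.Tactic.RingSolver using (solve-∀)
  open import Data.Nat.Tactic.RingSolver renaming (solve-∀ to ℕ-solve-∀)
  open import Data.Product using (Σ-syntax; _×_; _,_)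
  open import Relation.Nullary.Decidable using (¬?; _×-dec_)
  open import Relation.Unary using (Pred; Decidable; _∩_)
  open import Relation.Unary.Properties using (_∩?_)
  open import Relation.Binary.PropositionalEquality
    using (_≡_; refl; sym; trans; cong; cong₂; module ≡-Reasoning)
  open import Defs using (sq; tri2; t4; N4)
  open Counting
  open Boxes
  open Residues

  Weighted : (ℤ → ℤ) → ℕ → ℕ → ℕ → ℕ → V → ℤ
  Weighted f a₁ a₂ a₃ a₄ (x₁ , x₂ , x₃ , x₄) = + a₁ * f x₁ + + a₂ * f x₂ + + a₃ * f x₃ + + a₄ * f x₄

  Diag Tri : ℕ → ℕ → ℕ → ℕ → V → ℤ
  Diag = Weighted sq
  Tri = Weighted tri2

  Rep : (V → ℤ) → ℤ → Pred V 0ℓ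
  Rep Q M v = Q v ≡ M

  Rep? : ∀ Q M → Decidable (Rep Q M)
  Rep? Q M v = Q v ≟ M

  private
    weights-bound : ∀ {c₁ c₂ c₃ c₄ t₁ t₂ t₃ t₄ M} →
      + suc c₁ * + t₁ + + suc c₂ * + t₂ + + suc c₃ * + t₃ + + suc c₄ * + t₄ ≡ + M →
      t₁ ≤ M × t₂ ≤ M × t₃ ≤ M × t₄ ≤ M
    weights-bound {c₁} {c₂} {c₃} {c₄} {t₁} {t₂} {t₃} {t₄} eq =
      ℕ.≤-trans (ℕ.m≤n*m t₁ (suc c₁)) (ℕ.m+n≤o⇒m≤o s₁ s₁₂≤M) ,
      ℕ.≤-trans (ℕ.m≤n*m t₂ (suc c₂)) (ℕ.m+n≤o⇒n≤o s₁ s₁₂≤M) ,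
      ℕ.≤-trans (ℕ.m≤n*m t₃ (suc c₃)) (ℕ.m+n≤o⇒n≤o (s₁ ℕ.+ s₂) s₁₂₃≤M) ,
      ℕ.≤-trans (ℕ.m≤n*m t₄ (suc c₄)) (ℕ.m+n≤o⇒n≤o (s₁ ℕ.+ s₂ ℕ.+ s₃) s₁₂₃₄≤M)
      where
      s₁ = suc c₁ ℕ.* t₁
      s₂ = suc c₂ ℕ.* t₂
      s₃ = suc c₃ ℕ.* t₃
      s₄ = suc c₄ ℕ.* t₄
      s₁₂₃₄≤M : s₁ ℕ.+ s₂ ℕ.+ s₃ ℕ.+ s₄ ≤ _
      s₁₂₃₄≤M = ℕ.≤-reflexive (+-injective (trans (cong₂ _+_ (cong₂ _+_ (cong₂ _+_
        (pos-* (suc c₁) t₁) (pos-* (suc c₂) t₂)) (pos-* (suc c₃) t₃)) (pos-* (suc c₄) t₄)) eq))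
      s₁₂₃≤M = ℕ.m+n≤o⇒m≤o (s₁ ℕ.+ s₂ ℕ.+ s₃) s₁₂₃₄≤M
      s₁₂≤M = ℕ.m+n≤o⇒m≤o (s₁ ℕ.+ s₂) s₁₂₃≤M

    weighted-bounded : ∀ {f a₁ a₂ a₃ a₄ M B} → (∀ x → Σ[ t ∈ ℕ ] f x ≡ + t × (t ≤ M → ∣ x ∣ ≤ B)) →
      Bounded (Rep (Weighted f (suc a₁) (suc a₂) (suc a₃) (suc a₄)) (+ M)) B
    weighted-bounded {a₁ = a₁} {a₂} {a₃} {a₄} nonneg = bounded λ (x₁ , x₂ , x₃ , x₄) eq →
      let t₁ , f₁ , b₁ = nonneg x₁ ; t₂ , f₂ , b₂ = nonneg x₂
          t₃ , f₃ , b₃ = nonneg x₃ ; t₄ , f₄ , b₄ = nonneg x₄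
          s₁ , s₂ , s₃ , s₄ = weights-bound {a₁} {a₂} {a₃} {a₄} (trans (sym (cong₂ _+_ (cong₂ _+_
            (cong₂ _+_ (cong (+ suc a₁ *_) f₁) (cong (+ suc a₂ *_) f₂)) (cong (+ suc a₃ *_) f₃))
            (cong (+ suc a₄ *_) f₄))) eq)
      in ∈-box4 (b₁ s₁) (b₂ s₂) (b₃ s₃) (b₄ s₄)

  diag-bounded : ∀ a₁ a₂ a₃ a₄ M → Bounded (Rep (Diag (suc a₁) (suc a₂) (suc a₃) (suc a₄)) (+ M)) M
  diag-bounded a₁ a₂ a₃ a₄ M = weighted-bounded {sq} {a₁} {a₂} {a₃} {a₄} {M} λ x →
    ∣ x ∣ ℕ.* ∣ x ∣ , sq≡∣∣² x , ℕ.≤-trans (n≤n*n ∣ x ∣)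
    where
    sq≡∣∣² : ∀ x → sq x ≡ + (∣ x ∣ ℕ.* ∣ x ∣)
    sq≡∣∣² (+ n) = sym (pos-* n n)
    sq≡∣∣² -[1+ n ] = refl
    n≤n*n : ∀ n → n ≤ n ℕ.* n
    n≤n*n zero = z≤n
    n≤n*n (suc n) = ℕ.m≤m*n (suc n) (suc n)

  tri-bounded : ∀ a₁ a₂ a₃ a₄ n →
    Bounded (Rep (Tri (suc a₁) (suc a₂) (suc a₃) (suc a₄)) (+ (2 ℕ.* n))) (suc n)
  tri-bounded a₁ a₂ a₃ a₄ n = weighted-bounded {tri2} {a₁} {a₂} {a₃} {a₄} {2 ℕ.* n} tri2-bound
    where
    2≤2+n : ∀ {n} → 2 ≤ suc (suc n)
    2≤2+n = s≤s (s≤s z≤n)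
    tri2-bound : ∀ x → Σ[ t ∈ ℕ ] tri2 x ≡ + t × (t ≤ 2 ℕ.* n → ∣ x ∣ ≤ suc n)
    tri2-bound (+ zero) = 0 , refl , λ _ → z≤n
    tri2-bound (+ suc zero) = 0 , refl , λ _ → s≤s z≤n
    tri2-bound (+ suc (suc j)) = suc (suc j) ℕ.* suc j , sym (pos-* (suc (suc j)) (suc j)) ,
      λ t≤2n → s≤s (ℕ.*-cancelˡ-≤ 2 (ℕ.≤-trans (ℕ.*-monoˡ-≤ (suc j) {2} {suc (suc j)} 2≤2+n) t≤2n))
    tri2-bound -[1+ j ] = suc j ℕ.* suc (suc (j ℕ.+ 0)) , refl ,
      λ t≤2n → ℕ.m≤n⇒m≤1+n (ℕ.*-cancelˡ-≤ 2 (ℕ.≤-trans (ℕ.≤-reflexive (ℕ.*-comm 2 (suc j)))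
        (ℕ.≤-trans (ℕ.*-monoʳ-≤ (suc j) 2≤2+n) t≤2n)))

  AllOdd : Pred V 0ℓ
  AllOdd (x₁ , x₂ , x₃ , x₄) = Odd x₁ × Odd x₂ × Odd x₃ × Odd x₄

  AllOdd? : Decidable AllOdd
  AllOdd? (x₁ , x₂ , x₃ , x₄) =
    ¬? (Even? x₁) ×-dec ¬? (Even? x₂) ×-dec ¬? (Even? x₃) ×-dec ¬? (Even? x₄)

  module _ (a₁ a₂ a₃ a₄ n : ℕ) where
    private
      c₁ = suc a₁
      c₂ = suc a₂
      c₃ = suc a₃
      c₄ = suc a₄
      S = c₁ ℕ.+ c₂ ℕ.+ c₃ ℕ.+ c₄
      M = 8 ℕ.* n ℕ.+ S

      odd-map odd-map⁻¹ : V → V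
      odd-map (x₁ , x₂ , x₃ , x₄) =
        + 2 * x₁ - + 1 , + 2 * x₂ - + 1 , + 2 * x₃ - + 1 , + 2 * x₄ - + 1
      odd-map⁻¹ (y₁ , y₂ , y₃ , y₄) =
        half (y₁ + + 1) , half (y₂ + + 1) , half (y₃ + + 1) , half (y₄ + + 1)

      Diag∘odd-map : ∀ v → Diag c₁ c₂ c₃ c₄ (odd-map v) ≡ + 4 * Tri c₁ c₂ c₃ c₄ v + + S
      Diag∘odd-map (x₁ , x₂ , x₃ , x₄) = lemma (+ c₁) (+ c₂) (+ c₃) (+ c₄) x₁ x₂ x₃ x₄
        where
        lemma : ∀ c₁ c₂ c₃ c₄ x₁ x₂ x₃ x₄ →
          c₁ * ((+ 2 * x₁ - + 1) * (+ 2 * x₁ - + 1)) + c₂ * ((+ 2 * x₂ - + 1) * (+ 2 * x₂ - + 1)) +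
          c₃ * ((+ 2 * x₃ - + 1) * (+ 2 * x₃ - + 1)) + c₄ * ((+ 2 * x₄ - + 1) * (+ 2 * x₄ - + 1)) ≡
          + 4 * (c₁ * (x₁ * (x₁ - + 1)) + c₂ * (x₂ * (x₂ - + 1)) + c₃ * (x₃ * (x₃ - + 1)) +
                 c₄ * (x₄ * (x₄ - + 1))) + (c₁ + c₂ + c₃ + c₄)
        lemma = solve-∀

      4[2n]+S≡M : + 4 * + (2 ℕ.* n) + + S ≡ + M
      4[2n]+S≡M = cong (_+ + S) (trans (sym (pos-* 4 (2 ℕ.* n))) (cong +_ (lemma n)))
        where
        lemma : ∀ n → 4 ℕ.* (2 ℕ.* n) ≡ 8 ℕ.* n
        lemma = ℕ-solve-∀

      half-odd : ∀ x → half (+ 2 * x - + 1 + + 1) ≡ x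
      half-odd x = trans (cong half (lemma x)) (half-double x)
        where
        lemma : ∀ x → + 2 * x - + 1 + + 1 ≡ + 2 * x
        lemma = solve-∀

      odd-half : ∀ y → Odd y → + 2 * half (y + + 1) - + 1 ≡ y
      odd-half y o = trans (cong (_- + 1) (half-spec (y + + 1) (odd⇒even-suc y o))) (lemma y)
        where
        lemma : ∀ y → y + + 1 - + 1 ≡ y
        lemma = solve-∀

      to-from : ∀ w → (Rep (Diag c₁ c₂ c₃ c₄) (+ M) ∩ AllOdd) w → odd-map (odd-map⁻¹ w) ≡ w
      to-from (y₁ , y₂ , y₃ , y₄) (_ , o₁ , o₂ , o₃ , o₄) =
        ≡-tuple (odd-half y₁ o₁) (odd-half y₂ o₂) (odd-half y₃ o₃) (odd-half y₄ o₄)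

    odd-squares : Rep (Tri c₁ c₂ c₃ c₄) (+ (2 ℕ.* n)) ≅ Rep (Diag c₁ c₂ c₃ c₄) (+ M) ∩ AllOdd
    odd-squares = record
      { to = odd-map
      ; from = odd-map⁻¹
      ; to-∈ = λ v@(x₁ , x₂ , x₃ , x₄) t≡2n →
          trans (Diag∘odd-map v) (trans (cong (λ t → + 4 * t + + S) t≡2n) 4[2n]+S≡M) ,
          odd-2x-1 x₁ , odd-2x-1 x₂ , odd-2x-1 x₃ , odd-2x-1 x₄
      ; from-∈ = λ w w∈@(d≡M , _) → *-cancelˡ-≡ (+ 4) _ _ (+-cancelʳ (+ S) (begin
          + 4 * Tri c₁ c₂ c₃ c₄ (odd-map⁻¹ w) + + S ≡⟨ Diag∘odd-map (odd-map⁻¹ w) ⟨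
          Diag c₁ c₂ c₃ c₄ (odd-map (odd-map⁻¹ w))  ≡⟨ cong (Diag c₁ c₂ c₃ c₄) (to-from w w∈) ⟩
          Diag c₁ c₂ c₃ c₄ w                       ≡⟨ d≡M ⟩
          + M                                      ≡⟨ 4[2n]+S≡M ⟨
          + 4 * + (2 ℕ.* n) + + S                  ∎))
      ; from-to = λ (x₁ , x₂ , x₃ , x₄) _ →
          ≡-tuple (half-odd x₁) (half-odd x₂) (half-odd x₃) (half-odd x₄)
      ; to-from = to-from
      }
      where
      open ≡-Reasoning
      +-cancelʳ : ∀ k {i j} → i + k ≡ j + k → i ≡ j
      +-cancelʳ k {i} {j} eq = trans (lemma i k) (trans (cong (_- k) eq) (sym (lemma j k)))
        where
        lemma : ∀ i k → i ≡ i + k - k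
        lemma = solve-∀

    t4≡count-odd-representations :
      t4 c₁ c₂ c₃ c₄ n ≡ count (Rep? (Diag c₁ c₂ c₃ c₄) (+ M) ∩? AllOdd?) M
    t4≡count-odd-representations = count-≅ {B = suc n} {M}
      (Rep? (Tri c₁ c₂ c₃ c₄) (+ (2 ℕ.* n))) (Rep? (Diag c₁ c₂ c₃ c₄) (+ M) ∩? AllOdd?)
      (tri-bounded a₁ a₂ a₃ a₄ n) (∩-bounded (diag-bounded a₁ a₂ a₃ a₄ M)) odd-squares

  res-Diag : ∀ a₁ a₂ a₃ a₄ x₁ x₂ x₃ x₄ →
    res (Diag a₁ a₂ a₃ a₄ (+ res x₁ , + res x₂ , + res x₃ , + res x₄)) ≡
    res (Diag a₁ a₂ a₃ a₄ (x₁ , x₂ , x₃ , x₄))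
  res-Diag a₁ a₂ a₃ a₄ x₁ x₂ x₃ x₄ = res-≡₈
    (≡₈-+ (≡₈-+ (≡₈-+ (term a₁ x₁) (term a₂ x₂)) (term a₃ x₃)) (term a₄ x₄))
    where
    term : ∀ a x → + a * sq (+ res x) ≡₈ + a * sq x
    term a x = ≡₈-* (≡₈-refl (+ a)) (≡₈-* (res≡₈ x) (res≡₈ x))

  rotate : V → V
  rotate (x₁ , x₂ , x₃ , x₄) = x₃ , x₄ , x₁ , x₂

  Weighted-rotate : ∀ f a₁ a₂ a₃ a₄ v → Weighted f a₃ a₄ a₁ a₂ (rotate v) ≡ Weighted f a₁ a₂ a₃ a₄ v
  Weighted-rotate f a₁ a₂ a₃ a₄ (x₁ , x₂ , x₃ , x₄) =
    lemma (+ a₁ * f x₁) (+ a₂ * f x₂) (+ a₃ * f x₃) (+ a₄ * f x₄)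
    where
    lemma : ∀ p q r s → r + s + p + q ≡ p + q + r + s
    lemma = solve-∀

  rotation : ∀ f a₁ a₂ a₃ a₄ K → Rep (Weighted f a₁ a₂ a₃ a₄) K ≅ Rep (Weighted f a₃ a₄ a₁ a₂) K
  rotation f a₁ a₂ a₃ a₄ K = record
    { to = rotate
    ; from = rotate
    ; to-∈ = λ v r → trans (Weighted-rotate f a₁ a₂ a₃ a₄ v) r
    ; from-∈ = λ w r → trans (Weighted-rotate f a₃ a₄ a₁ a₂ w) r
    ; from-to = λ _ _ → refl
    ; to-from = λ _ _ → refl
    }

  N4-rotate : ∀ a₁ a₂ a₃ a₄ M →
    N4 (suc a₁) (suc a₂) (suc a₃) (suc a₄) M ≡ N4 (suc a₃) (suc a₄) (suc a₁) (suc a₂) M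
  N4-rotate a₁ a₂ a₃ a₄ M = count-≅ {B = M} {M}
    (Rep? (Diag (suc a₁) (suc a₂) (suc a₃) (suc a₄)) (+ M))
    (Rep? (Diag (suc a₃) (suc a₄) (suc a₁) (suc a₂)) (+ M))
    (diag-bounded a₁ a₂ a₃ a₄ M) (diag-bounded a₃ a₄ a₁ a₂ M)
    (rotation sq (suc a₁) (suc a₂) (suc a₃) (suc a₄) (+ M))

  t4-rotate : ∀ a₁ a₂ a₃ a₄ n →
    t4 (suc a₁) (suc a₂) (suc a₃) (suc a₄) n ≡ t4 (suc a₃) (suc a₄) (suc a₁) (suc a₂) n
  t4-rotate a₁ a₂ a₃ a₄ n = count-≅ {B = suc n} {suc n}
    (Rep? (Tri (suc a₁) (suc a₂) (suc a₃) (suc a₄)) (+ (2 ℕ.* n)))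
    (Rep? (Tri (suc a₃) (suc a₄) (suc a₁) (suc a₂)) (+ (2 ℕ.* n)))
    (tri-bounded a₁ a₂ a₃ a₄ n) (tri-bounded a₃ a₄ a₁ a₂ n)
    (rotation tri2 (suc a₁) (suc a₂) (suc a₃) (suc a₄) (+ (2 ℕ.* n)))

module Family where

  open import Level using (0ℓ)
  open import Function using (_∘_)
  open import Data.Nat as ℕ using (ℕ; suc)
  open import Data.Integer using (ℤ; +_; _+_; _*_; -_; _-_)
  open import Data.Integer.Properties using (pos-*; *-cancelˡ-≡; neg-involutive)
  open import Data.Integer.Tactic.RingSolver using (solve-∀)
  open import Data.Nat.Tactic.RingSolver renaming (solve-∀ to ℕ-solve-∀)
  open import Data.Product using (_×_; _,_; proj₁; proj₂)
  open import Relation.Nullary using (¬_; Dec)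
  open import Relation.Nullary.Decidable using (¬?; _×-dec_; _→-dec_)
  open import Relation.Unary using (Pred; Decidable; _∩_; ∁)
  open import Relation.Unary.Properties using (_∩?_; ∁?)
  open import Relation.Binary.PropositionalEquality
    using (_≡_; refl; sym; trans; cong; cong₂; subst; subst₂; module ≡-Reasoning)
  open import Defs using (N4; t4)
  open Counting
  open Boxes
  open Residues
  open Substitutions
  open Forms

  t≡2N₁-N₂ : ∀ {t N₁ N₂} e o →
    t ≡ e → N₁ ≡ e ℕ.+ (o ℕ.+ o) → N₂ ≡ (e ℕ.+ o) ℕ.+ (o ℕ.+ (o ℕ.+ o)) → + t ≡ + (2 ℕ.* N₁) - + N₂
  t≡2N₁-N₂ e o refl refl refl =
    sym (trans (cong (λ k → + k - + N₂) (lemma e o)) (lemma′ (+ e) (+ N₂)))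
    where
    N₂ = (e ℕ.+ o) ℕ.+ (o ℕ.+ (o ℕ.+ o))
    lemma : ∀ e o → 2 ℕ.* (e ℕ.+ (o ℕ.+ o)) ≡ e ℕ.+ ((e ℕ.+ o) ℕ.+ (o ℕ.+ (o ℕ.+ o)))
    lemma = ℕ-solve-∀
    lemma′ : ∀ a b → a + b - b ≡ a
    lemma′ = solve-∀

  -- g = suc g-1 and h = suc h-1, so that the coefficients of F and G are definitionally positive.
  module Family (g-1 h-1 n : ℕ) where
    g h m M : ℕ
    g = suc g-1
    h = suc h-1
    m = 8 ℕ.* n ℕ.+ (g ℕ.+ (g ℕ.+ g) ℕ.+ (h ℕ.+ h) ℕ.+ (h ℕ.+ h))
    M = 2 ℕ.* m

    F G : V → ℤ
    F = Diag g (g ℕ.+ g) (h ℕ.+ h) (h ℕ.+ h)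
    G = Diag g (g ℕ.+ g) h h

    N : ℕ → ℕ
    N = N4 g (g ℕ.+ g) (h ℕ.+ h) (h ℕ.+ h)

    t : ℕ
    t = t4 g (g ℕ.+ g) (h ℕ.+ h) (h ℕ.+ h) n

    F-bounded : ∀ K → Bounded (Rep F (+ K)) K
    F-bounded = diag-bounded g-1 (g-1 ℕ.+ g) (h-1 ℕ.+ h) (h-1 ℕ.+ h)

    S : Pred V 0ℓ
    S = Rep G (+ m)

    S-bounded : Bounded S m
    S-bounded = diag-bounded g-1 (g-1 ℕ.+ g) h-1 h-1 m

    S? : Decidable S
    S? = Rep? G (+ m)

    X≡₄B : Pred V 0ℓ
    X≡₄B v = π₁ v ≡₄ π₄ v

    X≡₄B? : Decidable X≡₄B
    X≡₄B? v = π₁ v ≡₄? π₄ v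

    Sₑ Sₒ Sₑₑ Sₑₒ Sₒₑ Sₒₒ Sₒₒ⁺ Sₒₒ⁻ : Pred V 0ℓ
    Sₑ = S ∩ Even ∘ π₃
    Sₒ = S ∩ Odd ∘ π₃
    Sₑₑ = Sₑ ∩ Even ∘ π₄
    Sₑₒ = Sₑ ∩ Odd ∘ π₄
    Sₒₑ = Sₒ ∩ Even ∘ π₄
    Sₒₒ = Sₒ ∩ Odd ∘ π₄
    Sₒₒ⁺ = Sₒₒ ∩ X≡₄B
    Sₒₒ⁻ = Sₒₒ ∩ ∁ X≡₄B

    Sₑ? : Decidable Sₑ
    Sₑ? = S? ∩? Even? ∘ π₃
    Sₒ? : Decidable Sₒ
    Sₒ? = S? ∩? ∁? (Even? ∘ π₃)
    Sₑₑ? : Decidable Sₑₑ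
    Sₑₑ? = Sₑ? ∩? Even? ∘ π₄
    Sₑₒ? : Decidable Sₑₒ
    Sₑₒ? = Sₑ? ∩? ∁? (Even? ∘ π₄)
    Sₒₑ? : Decidable Sₒₑ
    Sₒₑ? = Sₒ? ∩? Even? ∘ π₄
    Sₒₒ? : Decidable Sₒₒ
    Sₒₒ? = Sₒ? ∩? ∁? (Even? ∘ π₄)
    Sₒₒ⁺? : Decidable Sₒₒ⁺
    Sₒₒ⁺? = Sₒₒ? ∩? X≡₄B?
    Sₒₒ⁻? : Decidable Sₒₒ⁻
    Sₒₒ⁻? = Sₒₒ? ∩? ∁? X≡₄B?

    -- These depend on g, h and on m mod 8, so each instance decides them by exhaustion.
    record ResidueConstraints : Set where
      field
        odd-g     : Odd (+ g)
        even-even : ∀ x y a b → S (x , y , a , b) → Even a → Even b → Odd x × Odd y × ¬ a ≡₄ b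
        odd-odd   : ∀ x y a b → S (x , y , a , b) → Odd a → Odd b → Odd x
        odd-even  : ∀ x y a b → S (x , y , a , b) → Odd a → Even b → Even x × ¬ x ≡₄ b

    ResidueCheck : ℕ → Set
    ResidueCheck r = ∀₈ λ x → ∀₈ λ y → ∀₈ λ a → ∀₈ λ b → res (G (+ x , + y , + a , + b)) ≡ r →
      (even a → even b → odd x × odd y × ¬ a ℕ.% 4 ≡ b ℕ.% 4) × (odd a → odd b → odd x) ×
      (odd a → even b → even x × ¬ x ℕ.% 4 ≡ b ℕ.% 4)

    residue-check? : ∀ r → Dec (ResidueCheck r)
    residue-check? r = ∀₈? λ x → ∀₈? λ y → ∀₈? λ a → ∀₈? λ b →
      res (G (+ x , + y , + a , + b)) ℕ.≟ r →-dec
      ((even? a →-dec even? b →-dec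
          ¬? (even? x) ×-dec ¬? (even? y) ×-dec ¬? (a ℕ.% 4 ℕ.≟ b ℕ.% 4)) ×-dec
       (¬? (even? a) →-dec ¬? (even? b) →-dec ¬? (even? x)) ×-dec
       (¬? (even? a) →-dec even? b →-dec even? x ×-dec ¬? (x ℕ.% 4 ℕ.≟ b ℕ.% 4)))

    residue-constraints : ∀ {r} → Odd (+ g) → res (+ m) ≡ r → ResidueCheck r → ResidueConstraints
    residue-constraints odd-g m≡r check = record
      { odd-g = odd-g
      ; even-even = λ x y a b → proj₁ ∘ at x y a b
      ; odd-odd = λ x y a b → proj₁ ∘ proj₂ ∘ at x y a b
      ; odd-even = λ x y a b → proj₂ ∘ proj₂ ∘ at x y a b
      }
      where
      at : ∀ x y a b → S (x , y , a , b) →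
        (Even a → Even b → Odd x × Odd y × ¬ a ≡₄ b) × (Odd a → Odd b → Odd x) ×
        (Odd a → Even b → Even x × ¬ x ≡₄ b)
      at x y a b s = check (res<8 x) (res<8 y) (res<8 a) (res<8 b)
        (trans (res-Diag g (g ℕ.+ g) h h x y a b) (trans (cong res s) m≡r))

    private
      γ η : ℤ
      γ = + g
      η = + h

    2m≡M : + 2 * + m ≡ + M
    2m≡M = sym (pos-* 2 m)

    F-double : ∀ x y a b → F (+ 2 * y , x , a , b) ≡ + 2 * G (x , y , a , b)
    F-double x y a b = lemma γ η x y a b
      where
      lemma : ∀ γ η x y a b →
        γ * ((+ 2 * y) * (+ 2 * y)) + (γ + γ) * (x * x) + (η + η) * (a * a) + (η + η) * (b * b) ≡
        + 2 * (γ * (x * x) + (γ + γ) * (y * y) + η * (a * a) + η * (b * b))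
      lemma = solve-∀

    even-first : Odd γ → ∀ v → F v ≡ + M → Even (π₁ v)
    even-first odd-γ (v₁ , v₂ , v₃ , v₄) f = odd-multiple-of-square γ v₁ odd-γ
      (even-of-sum (γ * (v₁ * v₁)) r (+ m) (trans (lemma γ η v₁ v₂ v₃ v₄) (trans f (sym 2m≡M))))
      where
      r = γ * (v₂ * v₂) + η * (v₃ * v₃) + η * (v₄ * v₄)
      lemma : ∀ γ η v₁ v₂ v₃ v₄ →
        γ * (v₁ * v₁) + + 2 * (γ * (v₂ * v₂) + η * (v₃ * v₃) + η * (v₄ * v₄)) ≡
        γ * (v₁ * v₁) + (γ + γ) * (v₂ * v₂) + (η + η) * (v₃ * v₃) + (η + η) * (v₄ * v₄)
      lemma = solve-∀

    pair unpair : V → V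
    pair (x , y , z , w) = x , y , z + w , z - w
    unpair (x , y , a , b) = x , y , b + half (a - b) , half (a - b)

    G∘pair : ∀ v → G (pair v) ≡ F v
    G∘pair (x , y , z , w) = lemma γ η x y z w
      where
      lemma : ∀ γ η x y z w →
        γ * (x * x) + (γ + γ) * (y * y) + η * ((z + w) * (z + w)) + η * ((z - w) * (z - w)) ≡
        γ * (x * x) + (γ + γ) * (y * y) + (η + η) * (z * z) + (η + η) * (w * w)
      lemma = solve-∀

    unpair-pair : ∀ v → unpair (pair v) ≡ v
    unpair-pair (x , y , z , w) = cong₂ (λ s t → x , y , s , t)
      (trans (cong (λ t → (z - w) + t) (half-pair z w)) (lemma z w)) (half-pair z w)
      where
      lemma : ∀ z w → z - w + w ≡ z
      lemma = solve-∀

    pair-unpair : ∀ w → Even (π₃ w - π₄ w) → pair (unpair w) ≡ w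
    pair-unpair (x , y , a , b) e =
      cong₂ (λ s t → x , y , s , t) (unpair-sum a b e) (unpair-difference b (half (a - b)))

    G-exchange : ∀ x y a b → G (x , y , b , a) ≡ G (x , y , a , b)
    G-exchange x y a b = lemma γ η x y a b
      where
      lemma : ∀ γ η x y a b → γ * (x * x) + (γ + γ) * (y * y) + η * (b * b) + η * (a * a) ≡
                              γ * (x * x) + (γ + γ) * (y * y) + η * (a * a) + η * (b * b)
      lemma = solve-∀

    G-negate : ∀ x y a b → G (x , y , a , - b) ≡ G (x , y , a , b)
    G-negate x y a b = lemma γ η x y a b
      where
      lemma : ∀ γ η x y a b → γ * (x * x) + (γ + γ) * (y * y) + η * (a * a) + η * (- b * - b) ≡
                              γ * (x * x) + (γ + γ) * (y * y) + η * (a * a) + η * (b * b)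
      lemma = solve-∀

    EvenSum : Pred V 0ℓ
    EvenSum v = Even (π₃ v + π₄ v)

    EvenSum? : Decidable EvenSum
    EvenSum? v = Even? (π₃ v + π₄ v)

    -- σ acts on (x, b) when g = 1 and on (b, x) when h = 1, so each instance supplies ρ.
    record Reflection : Set where
      field
        ρ₁ ρ₂        : ℤ → ℤ → ℤ
        preserves-G  : ∀ x y a b → Even (x - b) → G (ρ₁ x b , y , a , ρ₂ x b) ≡ G (x , y , a , b)
        involutive   : ∀ x b → Even (x - b) → ρ₁ (ρ₁ x b) (ρ₂ x b) ≡ x × ρ₂ (ρ₁ x b) (ρ₂ x b) ≡ b
        odd-to-even  : ∀ x b → OddCongruent x b → Even (ρ₂ x b)
        even-to-odd  : ∀ x b → EvenIncongruent x b → Odd (ρ₂ x b) × ρ₁ x b ≡₄ ρ₂ x b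

    module Counts (constraints : ResidueConstraints) (ρ : Reflection) where
      open ResidueConstraints constraints
      open Reflection ρ

      doubling : Rep F (+ M) ≅ S
      doubling = record
        { to = halve
        ; from = double
        ; to-∈ = λ v f → *-cancelˡ-≡ (+ 2) _ _ (begin
            + 2 * G (halve v)    ≡⟨ F∘double (halve v) ⟨
            F (double (halve v)) ≡⟨ cong F (double∘halve v f) ⟩
            F v                  ≡⟨ f ⟩
            + M                  ≡⟨ 2m≡M ⟨
            + 2 * + m            ∎)
        ; from-∈ = λ w s → trans (F∘double w) (trans (cong (+ 2 *_) s) 2m≡M)
        ; from-to = double∘halve
        ; to-from = λ (x , y , a , b) _ → cong (λ k → x , k , a , b) (half-double y)
        }
        where
        open ≡-Reasoning
        halve double : V → V
        halve (v₁ , v₂ , v₃ , v₄) = v₂ , half v₁ , v₃ , v₄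
        double (x , y , a , b) = + 2 * y , x , a , b
        F∘double : ∀ w → F (double w) ≡ + 2 * G w
        F∘double (x , y , a , b) = F-double x y a b
        double∘halve : ∀ v → F v ≡ + M → double (halve v) ≡ v
        double∘halve v@(v₁ , v₂ , v₃ , v₄) f =
          cong (λ k → k , v₂ , v₃ , v₄) (half-spec v₁ (even-first odd-g v f))

      pairing : ∀ {C D : Pred V 0ℓ} → (∀ v → S (pair v) → C v → D (pair v)) →
        (∀ w → D w → S w × Even (π₃ w - π₄ w) × C (unpair w)) → Rep F (+ m) ∩ C ≅ D
      pairing to-D from-C = record
        { to = pair
        ; from = unpair
        ; to-∈ = λ v (f , c) → to-D v (trans (G∘pair v) f) c
        ; from-∈ = λ w d → let (s , e , c) = from-C w d in
            trans (sym (G∘pair (unpair w))) (trans (cong G (pair-unpair w e)) s) , c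
        ; from-to = λ v _ → unpair-pair v
        ; to-from = λ w d → pair-unpair w (proj₁ (proj₂ (from-C w d)))
        }

      pairing-even-sum : Rep F (+ m) ∩ EvenSum ≅ Sₑₑ
      pairing-even-sum = pairing
        (λ (_ , _ , z , w) s e → (s , e) , even-sum⇒even-difference z w e)
        (λ (_ , _ , a , b) ((s , ea) , eb) → let e = even-even⇒even-difference a b ea eb in
           s , e , subst Even (sym (unpair-sum a b e)) ea)

      pairing-odd-sum : Rep F (+ m) ∩ ∁ EvenSum ≅ Sₒₒ
      pairing-odd-sum = pairing
        (λ (_ , _ , z , w) s o → (s , o) , o ∘ even-difference⇒even-sum z w)
        (λ (_ , _ , a , b) ((s , oa) , ob) → let e = odd-odd⇒even-difference a b oa ob in
           s , e , oa ∘ subst Even (unpair-sum a b e))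

      pairing-all-odd : Rep F (+ m) ∩ AllOdd ≅ Sₑₑ
      pairing-all-odd = pairing
        (λ (_ , _ , z , w) s (_ , _ , oz , ow) →
           (s , odd-odd⇒even-sum z w oz ow) , odd-odd⇒even-difference z w oz ow)
        (λ (x , y , a , b) ((s , ea) , eb) →
           let (ox , oy , a≢b) = even-even x y a b s ea eb
               e = even-even⇒even-difference a b ea eb
               d = half (a - b)
               sum≡a = unpair-sum a b e
               difference≡b = unpair-difference b d
               (oz , ow) = EvenIncongruent-sum-difference⇒odd (b + d) d
                 (subst Even (sym sum≡a) ea , subst Even (sym difference≡b) eb ,
                  a≢b ∘ subst₂ _≡₄_ sum≡a difference≡b)
           in s , e , ox , oy , oz , ow)

      swap : Sₒₑ ≅ Sₑₒ
      swap = record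
        { to = exchange
        ; from = exchange
        ; to-∈ = λ (x , y , a , b) ((s , oa) , eb) → (trans (G-exchange x y a b) s , eb) , oa
        ; from-∈ = λ (x , y , a , b) ((s , ea) , ob) → (trans (G-exchange x y a b) s , ob) , ea
        ; from-to = λ _ _ → refl
        ; to-from = λ _ _ → refl
        }
        where
        exchange : V → V
        exchange (x , y , a , b) = x , y , b , a

      negation : Sₒₒ⁺ ≅ Sₒₒ⁻
      negation = record
        { to = negate
        ; from = negate
        ; to-∈ = λ (x , y , a , b) (((s , oa) , ob) , c) →
            ((trans (G-negate x y a b) s , oa) , odd-neg b ob) ,
            proj₁ (odd-≡₄-neg x b (odd-odd x y a b s oa ob) ob) c
        ; from-∈ = λ (x , y , a , b) (((s , oa) , ob) , c) →
            ((trans (G-negate x y a b) s , oa) , odd-neg b ob) ,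
            proj₂ (odd-≡₄-neg x b (odd-odd x y a b s oa ob) ob) c
        ; from-to = λ (x , y , a , b) _ → cong (λ k → x , y , a , k) (neg-involutive b)
        ; to-from = λ (x , y , a , b) _ → cong (λ k → x , y , a , k) (neg-involutive b)
        }
        where
        negate : V → V
        negate (x , y , a , b) = x , y , a , - b

      reflection : Sₒₒ⁺ ≅ Sₒₑ
      reflection = record
        { to = reflect
        ; from = reflect
        ; to-∈ = λ (x , y , a , b) (((s , oa) , ob) , c) →
            (reflect-S x y a b (odd-parity x y a b s oa ob) s , oa) ,
            odd-to-even x b (odd-odd x y a b s oa ob , ob , c)
        ; from-∈ = λ (x , y , a , b) ((s , oa) , eb) →
            let (ex , x≢b) = odd-even x y a b s oa eb
                (ob′ , c′) = even-to-odd x b (ex , eb , x≢b)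
            in ((reflect-S x y a b (even-parity x y a b s oa eb) s , oa) , ob′) , c′
        ; from-to = λ (x , y , a , b) (((s , oa) , ob) , _) →
            reflect-involutive x y a b (odd-parity x y a b s oa ob)
        ; to-from = λ (x , y , a , b) ((s , oa) , eb) →
            reflect-involutive x y a b (even-parity x y a b s oa eb)
        }
        where
        reflect : V → V
        reflect (x , y , a , b) = ρ₁ x b , y , a , ρ₂ x b
        reflect-S : ∀ x y a b → Even (x - b) → S (x , y , a , b) → S (reflect (x , y , a , b))
        reflect-S x y a b e = trans (preserves-G x y a b e)
        reflect-involutive : ∀ x y a b → Even (x - b) →
          reflect (reflect (x , y , a , b)) ≡ (x , y , a , b)
        reflect-involutive x y a b e =
          let (p , q) = involutive x b e in cong₂ (λ s t → s , y , a , t) p q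
        odd-parity : ∀ x y a b → S (x , y , a , b) → Odd a → Odd b → Even (x - b)
        odd-parity x y a b s oa ob = odd-odd⇒even-difference x b (odd-odd x y a b s oa ob) ob
        even-parity : ∀ x y a b → S (x , y , a , b) → Odd a → Even b → Even (x - b)
        even-parity x y a b s oa eb =
          even-even⇒even-difference x b (proj₁ (odd-even x y a b s oa eb)) eb

      #_ : ∀ {P : Pred V 0ℓ} → Decidable P → ℕ
      # P? = count P? m

      Fₘ-bounded : ∀ {C : Pred V 0ℓ} → Bounded (Rep F (+ m) ∩ C) m
      Fₘ-bounded = ∩-bounded (F-bounded m)

      Sᵢⱼ-bounded : ∀ {C D : Pred V 0ℓ} → Bounded ((S ∩ C) ∩ D) m
      Sᵢⱼ-bounded = ∩-bounded (∩-bounded S-bounded)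

      Sᵢⱼₖ-bounded : ∀ {C D E : Pred V 0ℓ} → Bounded (((S ∩ C) ∩ D) ∩ E) m
      Sᵢⱼₖ-bounded = ∩-bounded Sᵢⱼ-bounded

      Rₑₑ Rₒₑ : ℕ
      Rₑₑ = # Sₑₑ?
      Rₒₑ = # Sₒₑ?

      Sₒₒ-count : # Sₒₒ? ≡ Rₒₑ ℕ.+ Rₒₑ
      Sₒₒ-count = begin
        # Sₒₒ?              ≡⟨ count-split Sₒₒ? X≡₄B? m ⟩
        # Sₒₒ⁺? ℕ.+ # Sₒₒ⁻? ≡⟨ cong (# Sₒₒ⁺? ℕ.+_) Sₒₒ⁺≡Sₒₒ⁻ ⟨
        # Sₒₒ⁺? ℕ.+ # Sₒₒ⁺? ≡⟨ cong₂ ℕ._+_ Sₒₒ⁺-count Sₒₒ⁺-count ⟩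
        Rₒₑ ℕ.+ Rₒₑ         ∎
        where
        open ≡-Reasoning
        Sₒₒ⁺≡Sₒₒ⁻ : # Sₒₒ⁺? ≡ # Sₒₒ⁻?
        Sₒₒ⁺≡Sₒₒ⁻ = count-≅ Sₒₒ⁺? Sₒₒ⁻? Sᵢⱼₖ-bounded Sᵢⱼₖ-bounded negation
        Sₒₒ⁺-count : # Sₒₒ⁺? ≡ Rₒₑ
        Sₒₒ⁺-count = count-≅ Sₒₒ⁺? Sₒₑ? Sᵢⱼₖ-bounded Sᵢⱼ-bounded reflection

      t-count : t ≡ Rₑₑ
      t-count = trans (t4≡count-odd-representations g-1 (g-1 ℕ.+ g) (h-1 ℕ.+ h) (h-1 ℕ.+ h) n)
        (count-≅ (Rep? F (+ m) ∩? AllOdd?) Sₑₑ? Fₘ-bounded Sᵢⱼ-bounded pairing-all-odd)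

      N-count : N m ≡ Rₑₑ ℕ.+ (Rₒₑ ℕ.+ Rₒₑ)
      N-count = begin
        N m ≡⟨ count-split (Rep? F (+ m)) EvenSum? m ⟩
        # (Rep? F (+ m) ∩? EvenSum?) ℕ.+ # (Rep? F (+ m) ∩? ∁? EvenSum?)
          ≡⟨ cong₂ ℕ._+_
               (count-≅ (Rep? F (+ m) ∩? EvenSum?) Sₑₑ? Fₘ-bounded Sᵢⱼ-bounded pairing-even-sum)
               (count-≅ (Rep? F (+ m) ∩? ∁? EvenSum?) Sₒₒ? Fₘ-bounded Sᵢⱼ-bounded pairing-odd-sum) ⟩
        Rₑₑ ℕ.+ # Sₒₒ?          ≡⟨ cong (Rₑₑ ℕ.+_) Sₒₒ-count ⟩
        Rₑₑ ℕ.+ (Rₒₑ ℕ.+ Rₒₑ) ∎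
        where open ≡-Reasoning

      N-double-count : N M ≡ (Rₑₑ ℕ.+ Rₒₑ) ℕ.+ (Rₒₑ ℕ.+ (Rₒₑ ℕ.+ Rₒₑ))
      N-double-count = begin
        N M
          ≡⟨ count-≅ (Rep? F (+ M)) S? (F-bounded M) S-bounded doubling ⟩
        # S?
          ≡⟨ count-split S? (Even? ∘ π₃) m ⟩
        # Sₑ? ℕ.+ # Sₒ?
          ≡⟨ cong₂ ℕ._+_ (count-split Sₑ? (Even? ∘ π₄) m) (count-split Sₒ? (Even? ∘ π₄) m) ⟩
        (Rₑₑ ℕ.+ # Sₑₒ?) ℕ.+ (Rₒₑ ℕ.+ # Sₒₒ?)
          ≡⟨ cong₂ (λ p q → (Rₑₑ ℕ.+ p) ℕ.+ (Rₒₑ ℕ.+ q))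
               (sym (count-≅ Sₒₑ? Sₑₒ? Sᵢⱼ-bounded Sᵢⱼ-bounded swap)) Sₒₒ-count ⟩
        (Rₑₑ ℕ.+ Rₒₑ) ℕ.+ (Rₒₑ ℕ.+ (Rₒₑ ℕ.+ Rₒₑ)) ∎
        where open ≡-Reasoning

      identity : + t ≡ + (2 ℕ.* N m) - + N M
      identity = t≡2N₁-N₂ Rₑₑ Rₒₑ t-count N-count N-double-count

module Identities where

  open import Function using (_∘_)
  open import Data.Nat as ℕ using (ℕ)
  open import Data.Integer using (+_; _+_; _*_; _-_)
  open import Data.Integer.Tactic.RingSolver using (solve-∀)
  open import Data.Nat.Tactic.RingSolver renaming (solve-∀ to ℕ-solve-∀)
  open import Data.Product using (_,_; proj₁; proj₂)
  open import Relation.Nullary.Decidable using (from-yes)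
  open import Relation.Binary.PropositionalEquality
    using (_≡_; sym; trans; cong; cong₂; module ≡-Reasoning)
  open import Defs using (N4; t4)
  open Residues
  open Substitutions
  open Forms
  open Family

  module Identity₁ (n : ℕ) where
    open Family.Family 0 2 n

    constraints : ResidueConstraints
    constraints = residue-constraints (λ ()) (res-8n+k n 15) (from-yes (residue-check? 7))

    ρ : Reflection
    ρ = record
      { ρ₁ = σ₁
      ; ρ₂ = σ₂
      ; preserves-G = λ x y a b e → trans (lemma (σ₁ x b) y a (σ₂ x b))
          (trans (cong (_+ (+ 2 * (y * y) + + 3 * (a * a))) (σ-norm x b e)) (sym (lemma x y a b)))
      ; involutive = σ-involutive
      ; odd-to-even = λ x b c → proj₁ (proj₂ (σ-OddCongruent x b c))
      ; even-to-odd = λ x b c → let (_ , o , c′) = σ-EvenIncongruent x b c in o , c′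
      }
      where
      lemma : ∀ x y a b → + 1 * (x * x) + + 2 * (y * y) + + 3 * (a * a) + + 3 * (b * b) ≡
                          (x * x + + 3 * (b * b)) + (+ 2 * (y * y) + + 3 * (a * a))
      lemma = solve-∀

    identity₁ :
      + t4 1 2 6 6 n ≡ + (2 ℕ.* N4 1 2 6 6 (8 ℕ.* n ℕ.+ 15)) - + N4 1 2 6 6 (16 ℕ.* n ℕ.+ 30)
    identity₁ = trans (Counts.identity constraints ρ)
      (cong (λ k → + (2 ℕ.* N4 1 2 6 6 m) - + N4 1 2 6 6 k) (lemma n))
      where
      lemma : ∀ n → 2 ℕ.* (8 ℕ.* n ℕ.+ 15) ≡ 16 ℕ.* n ℕ.+ 30
      lemma = ℕ-solve-∀

  -- In the coordinates (c, d, a, b), ⟨2, 2, 3, 6⟩ is ⟨3, 6, 2, 2⟩, that is F for g = 3 and h = 1.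
  module Identity₂ (n : ℕ) where
    open Family.Family 2 0 n

    constraints : ResidueConstraints
    constraints = residue-constraints (λ ()) (res-8n+k n 13) (from-yes (residue-check? 5))

    ρ : Reflection
    ρ = record
      { ρ₁ = λ x b → σ₂ b x
      ; ρ₂ = λ x b → σ₁ b x
      ; preserves-G = λ x y a b e → trans (lemma (σ₂ b x) y a (σ₁ b x))
          (trans (cong (_+ (+ 6 * (y * y) + a * a)) (σ-norm b x (even-difference-comm x b e)))
            (sym (lemma x y a b)))
      ; involutive = λ x b e → let (p , q) = σ-involutive b x (even-difference-comm x b e) in q , p
      ; odd-to-even = λ x b (ox , ob , c) → proj₁ (σ-OddCongruent b x (ob , ox , sym c))
      ; even-to-odd = λ x b (ex , eb , x≢b) →
          let (o , _ , c′) = σ-EvenIncongruent b x (eb , ex , x≢b ∘ sym) in o , sym c′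
      }
      where
      lemma : ∀ x y a b → + 3 * (x * x) + + 6 * (y * y) + + 1 * (a * a) + + 1 * (b * b) ≡
                          (b * b + + 3 * (x * x)) + (+ 6 * (y * y) + a * a)
      lemma = solve-∀

    identity₂ :
      + t4 2 2 3 6 n ≡ + (2 ℕ.* N4 2 2 3 6 (8 ℕ.* n ℕ.+ 13)) - + N4 2 2 3 6 (16 ℕ.* n ℕ.+ 26)
    identity₂ = begin
      + t4 2 2 3 6 n ≡⟨ cong +_ (t4-rotate 1 1 2 5 n) ⟩
      + t4 3 6 2 2 n ≡⟨ Counts.identity constraints ρ ⟩
      + (2 ℕ.* N4 3 6 2 2 m) - + N4 3 6 2 2 (2 ℕ.* m)
        ≡⟨ cong₂ (λ p q → + (2 ℕ.* p) - + q) (N4-rotate 2 5 1 1 m)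
             (trans (N4-rotate 2 5 1 1 (2 ℕ.* m)) (cong (N4 2 2 3 6) (lemma n))) ⟩
      + (2 ℕ.* N4 2 2 3 6 (8 ℕ.* n ℕ.+ 13)) - + N4 2 2 3 6 (16 ℕ.* n ℕ.+ 26) ∎
      where
      open ≡-Reasoning
      lemma : ∀ n → 2 ℕ.* (8 ℕ.* n ℕ.+ 13) ≡ 16 ℕ.* n ℕ.+ 26
      lemma = ℕ-solve-∀

open import Data.Nat using (ℕ; _+_; _*_)
open import Data.Integer using (+_; _-_)
open import Data.Product using (_×_; _,_)
open import Relation.Binary.PropositionalEquality using (_≡_)
open import Defs using (t4; N4)
open Identities

-- The identities hold for n = 0 as well.
theorem5p17 : (n : ℕ) → 1 Data.Nat.≤ n →
    (+ t4 1 2 6 6 n ≡ + (2 * N4 1 2 6 6 (8 * n + 15)) - + N4 1 2 6 6 (16 * n + 30))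
    × (+ t4 2 2 3 6 n ≡ + (2 * N4 2 2 3 6 (8 * n + 13)) - + N4 2 2 3 6 (16 * n + 26))
theorem5p17 n _ = Identity₁.identity₁ n , Identity₂.identity₂ n
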